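{- Let $G$ be a subgraph of a fullerene graph $F$ with no vertices of degree 1. Let $f$ be a face of $G$ whose boundary contains vertices of degree 2 in $G$, and let $P$ be a degree-saturated path of $G$ on the boundary of $f$. Then the length of $P$ is at most 5.
   Context: A fullerene graph is a cubic 3-connected plane graph all of whose faces are pentagons or hexagons; it has exactly 12 pentagonal faces. A subgraph $G$ of $F$ inherits a plane embedding, and its faces are taken with respect to that embedding. A degree-saturated path on the boundary of a face $f$ of $G$ is a path along the boundary of $f$ that joins two vertices of degree 2 in $G$ and has no vertex of degree 2 in $G$ as an internal vertex. -}

module Defs where

open import Data.Nat using (ℕ; zero; suc; _+_; _≤_; _<_; _≤ᵇ_)
open import Data.Fin using (Fin; toℕ)
open import Data.Bool using (Bool; true; false; if_then_else_)
open import Data.List using (List; length; map; allFin; upTo)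
open import Data.Bool.ListAction using (and)
open import Data.Nat.ListAction using (sum)
open import Data.List.Relation.Unary.Any using (Any)
open import Data.Product using (_×_)
open import Data.Sum using (_⊎_)
open import Relation.Binary.PropositionalEquality using (_≡_; _≢_)
open import Relation.Nullary using (¬_)

iter : ∀ {A : Set} → (A → A) → ℕ → A → A
iter f zero    x = x
iter f (suc k) x = f (iter f k x)

count : ∀ {d} → (Fin d → Bool) → ℕ
count {d} b = sum (map (λ x → if b x then 1 else 0) (allFin d))

-- x is the (toℕ-)least element of its orbit under p
-- (orbits of a permutation of Fin d have length ≤ d)
isOrbitRep : ∀ {d} → (Fin d → Fin d) → Fin d → Bool
isOrbitRep {d} p x = and (map (λ k → toℕ x ≤ᵇ toℕ (iter p k x)) (upTo d))

orbitCount : ∀ {d} → (Fin d → Fin d) → ℕ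
orbitCount p = count (isOrbitRep p)

CycleLen : ∀ {d} → (Fin d → Fin d) → ℕ → Fin d → Set
CycleLen p n x = iter p n x ≡ x × (∀ k → 1 ≤ k → k < n → iter p k x ≢ x)

-- Combinatorial maps (rotation systems) on a finite set of darts Fin d.
-- α : the edge involution (a dart ↦ the opposite dart of its edge)
-- σ : the rotation (cyclic order of darts around their common vertex)
-- vertices = σ-orbits, edges = α-orbits, faces = orbits of φ = σ ∘ α.

module MapNotions {d : ℕ} (α σ : Fin d → Fin d) where

  -- darts x and y belong to the same vertex, for a cubic rotation (σ³ = id)
  SameV : Fin d → Fin d → Set
  SameV x y = y ≡ x ⊎ (y ≡ σ x ⊎ y ≡ σ (σ x))

  φ : Fin d → Fin d
  φ x = σ (α x)

  InVs : List (Fin d) → Fin d → Set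
  InVs X z = Any (λ a → SameV a z) X

  -- Reach R x y : there is a walk in the graph from the vertex of x to the
  -- vertex of y (reaching the dart y) that never enters a vertex satisfying R.
  data Reach (R : Fin d → Set) (x : Fin d) : Fin d → Set where
    here : Reach R x x
    turn : ∀ {y} → Reach R x y → Reach R x (σ y)
    step : ∀ {y} → Reach R x y → ¬ R (α y) → Reach R x (α y)

  -- 3-connected: more than 3 vertices (d = 3·#V ≥ 12) and deleting any set
  -- of at most 2 vertices leaves a connected graph.
  ThreeConnected : Set
  ThreeConnected =
    12 ≤ d ×
    (∀ (X : List (Fin d)) → length X ≤ 2 →
       ∀ x y → ¬ InVs X x → ¬ InVs X y → Reach (InVs X) x y)

record Fullerene (d : ℕ) : Set where
  field
    α σ      : Fin d → Fin d
  open MapNotions α σ public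
  field
    α-invol  : ∀ x → α (α x) ≡ x
    α-nofix  : ∀ x → α x ≢ x
    σ-cubic  : ∀ x → σ (σ (σ x)) ≡ x
    σ-nofix  : ∀ x → σ x ≢ x
    loopless : ∀ x → ¬ SameV x (α x)
    noMulti  : ∀ x y → SameV x y → SameV (α x) (α y) → x ≡ y
    threeConnected : ThreeConnected
    -- planarity (Euler's formula for the connected map): V + F = E + 2
    euler    : orbitCount σ + orbitCount φ ≡ orbitCount α + 2
    faces    : ∀ x → CycleLen φ 5 x ⊎ CycleLen φ 6 x

-- Subgraphs of a fullerene with the inherited embedding.
-- A subgraph is given by its edge set: a set S of darts closed under α.

module SubgraphNotions {d : ℕ} (F : Fullerene d) (S : Fin d → Bool) where
  open Fullerene F

  b2n : Bool → ℕ
  b2n true  = 1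
  b2n false = 0

  degG : Fin d → ℕ
  degG x = b2n (S x) + (b2n (S (σ x)) + b2n (S (σ (σ x))))

  σG : Fin d → Fin d
  σG x = if S (σ x) then σ x else (if S (σ (σ x)) then σ (σ x) else x)

  -- facial-walk permutation of G (its orbits on darts of G are the
  -- boundary walks of the faces of G)
  φG : Fin d → Fin d
  φG x = σG (α x)

  -- A degree-saturated path of length k on the boundary of a face of G:
  -- the k consecutive edges (darts φG^i x, i < k) of a facial walk of G,
  -- whose vertices v_i = vertex of φG^i x (i ≤ k) are pairwise distinct,
  -- with v_0 and v_k of degree 2 in G and no internal vertex of degree 2.
  DegSatPath : Fin d → ℕ → Set
  DegSatPath x k =
    S x ≡ true ×
    (∀ i j → i < j → j ≤ k → ¬ SameV (iter φG i x) (iter φG j x)) ×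
    degG x ≡ 2 ×
    degG (iter φG k x) ≡ 2 ×
    (∀ i → 1 ≤ i → i < k → degG (iter φG i x) ≢ 2)

-- Up to its first vertex of degree 2, the facial walk of G around f
-- follows the facial walk of F: at a vertex of degree 3 in G the successor
-- dart of F is present in G. Hence all but the last vertex of a
-- degree-saturated path lie on one face of F, a pentagon or a hexagon, and
-- a path of length at least 6 would return to its starting vertex.
module Submission where

open import Defs
open import Data.Nat using (ℕ; zero; suc; _+_; _≤_; _<_; _≤?_; z≤n; s≤s)
open import Data.Nat.Properties using (+-comm; +-assoc; m≤n⇒m≤1+n; <⇒≤; ≰⇒>)
open import Data.Fin using (Fin)
open import Data.Bool using (Bool; true; false)
open import Data.Product using (_×_; _,_; proj₁)
open import Data.Sum using (_⊎_; inj₁; inj₂)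
open import Relation.Nullary using (yes; no; contradiction)
open import Relation.Binary.PropositionalEquality

module _ {d : ℕ} (F : Fullerene d) where
  open Fullerene F

  SameV-σˡ : ∀ {y z} → SameV y z → SameV (σ y) z
  SameV-σˡ {y} (inj₁ z≡y)        = inj₂ (inj₂ (trans z≡y (sym (σ-cubic y))))
  SameV-σˡ     (inj₂ (inj₁ z≡σy)) = inj₁ z≡σy
  SameV-σˡ     (inj₂ (inj₂ z≡σσy)) = inj₂ (inj₁ z≡σσy)

  module _ (S : Fin d → Bool) where
    open SubgraphNotions F S

    σG-SameV : ∀ y → SameV y (σG y)
    σG-SameV y with S (σ y) | S (σ (σ y))
    ... | true  | _     = inj₂ (inj₁ refl)
    ... | false | true  = inj₂ (inj₂ refl)
    ... | false | false = inj₁ refl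

    degG-σ : ∀ y → degG (σ y) ≡ degG y
    degG-σ y = begin
      a + (b + S′ (σ (σ (σ y))))  ≡⟨ cong (λ t → a + (b + S′ t)) (σ-cubic y) ⟩
      a + (b + c)                 ≡⟨ sym (+-assoc a b c) ⟩
      (a + b) + c                 ≡⟨ +-comm (a + b) c ⟩
      c + (a + b)                 ∎
      where
      open ≡-Reasoning
      S′ : Fin d → ℕ
      S′ z = b2n (S z)
      a = S′ (σ y)
      b = S′ (σ (σ y))
      c = S′ y

    degG-SameV : ∀ {y z} → SameV y z → degG z ≡ degG y
    degG-SameV (inj₁ refl)        = refl
    degG-SameV {y} (inj₂ (inj₁ refl)) = degG-σ y
    degG-SameV {y} (inj₂ (inj₂ refl)) = trans (degG-σ (σ y)) (degG-σ y)

    σG≡σ : ∀ y → S (σ y) ≡ true → σG y ≡ σ y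
    σG≡σ y Sσy rewrite Sσy = refl

    S-σ-false⇒degG≡1⊎2 : ∀ y → S y ≡ true → S (σ y) ≡ false → degG y ≡ 1 ⊎ degG y ≡ 2
    S-σ-false⇒degG≡1⊎2 y Sy Sσy rewrite Sy | Sσy with S (σ (σ y))
    ... | false = inj₁ refl
    ... | true  = inj₂ refl

    degG≢1,2⇒S-σ : ∀ y → S y ≡ true → degG y ≢ 1 → degG y ≢ 2 → S (σ y) ≡ true
    degG≢1,2⇒S-σ y Sy deg≢1 deg≢2 = by-cases (S (σ y)) refl
      where
      by-cases : ∀ b → S (σ y) ≡ b → S (σ y) ≡ true
      by-cases true  Sσy = Sσy
      by-cases false Sσy with S-σ-false⇒degG≡1⊎2 y Sy Sσy
      ... | inj₁ deg≡1 = contradiction deg≡1 deg≢1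
      ... | inj₂ deg≡2 = contradiction deg≡2 deg≢2

    module _ (S-α : ∀ x → S (α x) ≡ S x) where

      φG≡φ : ∀ {w} → S w ≡ true → degG (φG w) ≢ 1 → degG (φG w) ≢ 2 →
             φG w ≡ φ w × S (φ w) ≡ true
      φG≡φ {w} Sw deg≢1 deg≢2 = σG≡σ (α w) Sφw , Sφw
        where
        sameDeg : degG (φG w) ≡ degG (α w)
        sameDeg = degG-SameV (σG-SameV (α w))
        Sφw : S (φ w) ≡ true
        Sφw = degG≢1,2⇒S-σ (α w) (trans (S-α w) Sw)
                (λ e → deg≢1 (trans sameDeg e)) (λ e → deg≢2 (trans sameDeg e))

      iter-φG≡iter-φ : (∀ y → degG y ≢ 1) → ∀ {x k} → S x ≡ true →
        (∀ i → 1 ≤ i → i < k → degG (iter φG i x) ≢ 2) →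
        ∀ i → i < k → iter φG i x ≡ iter φ i x × S (iter φ i x) ≡ true
      iter-φG≡iter-φ no1 Sx internal zero    _   = refl , Sx
      iter-φG≡iter-φ no1 Sx internal (suc i) i<k
        with iter-φG≡iter-φ no1 Sx internal i (<⇒≤ i<k)
      ... | walks≡ , Swᵢ
        with φG≡φ Swᵢ (no1 _) (subst (λ t → degG (φG t) ≢ 2) walks≡ (internal (suc i) (s≤s z≤n) i<k))
      ... | step≡ , Sφwᵢ = trans (cong φG walks≡) step≡ , Sφwᵢ

      DegSatPath-shorter-than-face : (∀ y → degG y ≢ 1) → ∀ {x k} n →
        DegSatPath x k → iter φ (suc n) x ≡ x → k ≤ n
      DegSatPath-shorter-than-face no1 {x} {k} n (Sx , distinct , _ , _ , internal) closed
        with k ≤? n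
      ... | yes k≤n = k≤n
      ... | no  k≰n = contradiction returns (distinct 0 (suc n) (s≤s z≤n) n<k)
        where
        n<k : n < k
        n<k = ≰⇒> k≰n
        -- With w = iter φG n x = iter φ n x, the dart φG w lies at the vertex of
        -- α w, which is the vertex of σ (α w) = iter φ (suc n) x = x.
        returns : SameV x (iter φG (suc n) x)
        returns = subst (λ t → SameV t (iter φG (suc n) x)) closed
          (SameV-σˡ (subst (λ t → SameV (α t) (φG (iter φG n x)))
            (proj₁ (iter-φG≡iter-φ no1 Sx internal n n<k))
            (σG-SameV (α (iter φG n x)))))

proposition2p3 : ∀ {d : ℕ} (F : Fullerene d) (S : Fin d → Bool) →
    (∀ x → S (Fullerene.α F x) ≡ S x) →
    (∀ x → SubgraphNotions.degG F S x ≢ 1) →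
    ∀ (x : Fin d) (k : ℕ) → SubgraphNotions.DegSatPath F S x k → k ≤ 5
proposition2p3 F S S-α no1 x k path with Fullerene.faces F x
... | inj₁ (pentagon , _) = m≤n⇒m≤1+n (DegSatPath-shorter-than-face F S S-α no1 4 path pentagon)
... | inj₂ (hexagon , _)  = DegSatPath-shorter-than-face F S S-α no1 5 path hexagon
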